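{- Let $(E,\mathcal{L})$ be a strong elimination system. Then $\mathcal{L}$ is a connected left regular band.
   Context: $L=\{0,+,-\}$ with $0$ an identity and $+x=+$, $-x=-$; for a finite set $E$, $L^E$ has componentwise product. For $x,y\in L^E$ the separation set is $S(x,y)=\{e\in E\mid x_e=-y_e\ne0\}$. A strong elimination system is a (nonempty) subset $\mathcal{L}\subseteq L^E$ such that (OM2) $x,y\in\mathcal{L}$ implies $xy\in\mathcal{L}$, and (OM3) for $x,y\in\mathcal{L}$ and $e\in S(x,y)$ there is $z\in\mathcal{L}$ with $z_e=0$ and $z_f=(xy)_f=(yx)_f$ for all $f\notin S(x,y)$. A left regular band is a semigroup with $x^2=x$, $xyx=xy$, ordered by $a\le b$ iff $ba=a$; $\Lambda(B)=\{Bb\}$; $B_{\ge X}=\{b\mid Bb\supseteq X\}$; $B$ is connected if the order complex $\Delta(B_{\ge X})$ is connected for every $X\in\Lambda(B)$. -}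

module Defs where

open import Level using (Level; _⊔_) renaming (suc to lsuc)
open import Data.Nat using (ℕ)
open import Data.Fin using (Fin)
open import Data.Vec using (Vec; zipWith; lookup)
open import Data.Product using (Σ; ∃; _×_)
open import Data.Sum using (_⊎_)
open import Relation.Nullary using (¬_)
open import Relation.Binary.PropositionalEquality using (_≡_; _≢_)
open import Relation.Binary.Construct.Closure.ReflexiveTransitive using (Star)

data Sign : Set where
  𝟘 ⊕ ⊖ : Sign

_·ₛ_ : Sign → Sign → Sign
𝟘 ·ₛ y = y
⊕ ·ₛ y = ⊕
⊖ ·ₛ y = ⊖

negₛ : Sign → Sign
negₛ 𝟘 = 𝟘
negₛ ⊕ = ⊖
negₛ ⊖ = ⊕

-- L^E with E = Fin n, componentwise product
Covector : ℕ → Set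
Covector n = Vec Sign n

_∘ᶜ_ : ∀ {n} → Covector n → Covector n → Covector n
_∘ᶜ_ = zipWith _·ₛ_

_∈S[_,_] : ∀ {n} → Fin n → Covector n → Covector n → Set
e ∈S[ x , y ] = (lookup x e ≡ negₛ (lookup y e)) × (lookup x e ≢ 𝟘)

record IsStrongEliminationSystem {ℓ} (n : ℕ) (ℒ : Covector n → Set ℓ) : Set ℓ where
  field
    nonempty : ∃ λ x → ℒ x
    OM2 : ∀ x y → ℒ x → ℒ y → ℒ (x ∘ᶜ y)
    OM3 : ∀ x y → ℒ x → ℒ y → ∀ e → e ∈S[ x , y ] →
          ∃ λ z → ℒ z × (lookup z e ≡ 𝟘)
                × (∀ f → ¬ (f ∈S[ x , y ]) → lookup z f ≡ lookup (x ∘ᶜ y) f)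

-- Left regular bands, given as a subset B of a type A closed under _·_
-- (equality of elements is equality in A).

module _ {a ℓ} {A : Set a} (B : A → Set ℓ) (_·_ : A → A → A) where

  record IsLeftRegularBand : Set (a ⊔ ℓ) where
    field
      closed : ∀ x y → B x → B y → B (x · y)
      assoc  : ∀ x y z → B x → B y → B z → (x · y) · z ≡ x · (y · z)
      idem   : ∀ x → B x → x · x ≡ x
      lrb    : ∀ x y → B x → B y → (x · y) · x ≡ x · y

  _≤B_ : A → A → Set a
  u ≤B v = v · u ≡ u

  _∈Ideal_ : A → A → Set (a ⊔ ℓ)
  y ∈Ideal b = ∃ λ c → B c × (y ≡ c · b)

  -- B_{≥X} for X = B x ∈ Λ(B):  { b ∈ B | B b ⊇ X }
  B≥ : A → A → Set (a ⊔ ℓ)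
  B≥ x b = B b × (∀ y → y ∈Ideal x → y ∈Ideal b)

  -- edges of the order complex Δ(B_{≥X}): comparable pairs in B_{≥X}
  ComparableIn : (A → Set (a ⊔ ℓ)) → A → A → Set (a ⊔ ℓ)
  ComparableIn P u v = P u × P v × (u ≤B v ⊎ v ≤B u)

  OrderComplexConnected : (A → Set (a ⊔ ℓ)) → Set (a ⊔ ℓ)
  OrderComplexConnected P = ∀ u v → P u → P v → Star (ComparableIn P) u v

  IsConnected : Set (a ⊔ ℓ)
  IsConnected = ∀ x → B x → OrderComplexConnected (B≥ x)

  record IsConnectedLeftRegularBand : Set (a ⊔ ℓ) where
    field
      isLRB     : IsLeftRegularBand
      connected : IsConnected

-- In a left regular band, b lies in B_{≥ Bx} exactly when x b = x, so each B_{≥X}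
-- is a subband, and two commuting elements u, v of it are joined by the path
-- u ≥ uv = vu ≤ v. For covectors, u and v commute as soon as their separation set
-- S(u,v) is empty. Otherwise eliminating some e ∈ S(u,v) by (OM3) yields z, again
-- in B_{≥X}, with S(u,z) and S(z,v) strictly inside S(u,v); induction on |S(u,v)|
-- joins u to z and z to v.
module Submission where

open import Defs
open import Level using (Level)
open import Data.Nat using (ℕ; _<_)
open import Data.Nat.Induction using (<-wellFounded)
open import Data.Bool using (Bool; true; false)
open import Data.Bool.Properties using () renaming (_≟_ to _≟ᵇ_)
open import Data.Fin using (Fin)
open import Data.Fin.Subset using (Subset; _∈_; _∉_; _⊂_; Empty; ∣_∣)
open import Data.Fin.Subset.Properties using (nonempty?; p⊂q⇒∣p∣<∣q∣)
open import Data.Vec using (zipWith; lookup)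
open import Data.Vec.Properties using
  (lookup-zipWith; zipWith-assoc; zipWith-idem; []=⇒lookup; lookup⇒[]=)
open import Data.Vec.Relation.Binary.Pointwise.Extensional using (ext; Pointwise-≡⇒≡)
open import Data.Product using (∃; _×_; _,_; proj₁)
open import Data.Sum using (inj₁; inj₂)
open import Data.Empty using (⊥-elim)
open import Function using (_∘_)
open import Induction.WellFounded using (Acc; acc)
open import Relation.Nullary using (Dec; yes; no)
open import Relation.Binary.PropositionalEquality
open import Relation.Binary.Construct.Closure.ReflexiveTransitive using (Star; ε; _◅_; _◅◅_)

module LeftRegularBandProperties {a ℓ} {A : Set a} {B : A → Set ℓ} {_·_ : A → A → A}
                                 (isLRB : IsLeftRegularBand B _·_) where
  open IsLeftRegularBand isLRB
  open ≡-Reasoning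

  B≥⇒absorbs : ∀ {x b} → B x → B≥ B _·_ x b → x · b ≡ x
  B≥⇒absorbs {x} {b} Bx (Bb , Bx⊆Bb) with Bx⊆Bb x (x , Bx , sym (idem x Bx))
  ... | c , Bc , x≡cb = begin
    x · b        ≡⟨ cong (_· b) x≡cb ⟩
    (c · b) · b  ≡⟨ assoc c b b Bc Bb Bb ⟩
    c · (b · b)  ≡⟨ cong (c ·_) (idem b Bb) ⟩
    c · b        ≡⟨ sym x≡cb ⟩
    x            ∎

  absorbs⇒B≥ : ∀ {x b} → B x → B b → x · b ≡ x → B≥ B _·_ x b
  absorbs⇒B≥ {x} {b} Bx Bb xb≡x = Bb , λ where
    _ (c , Bc , refl) → c · x , closed c x Bc Bx ,
      (begin
        c · x        ≡⟨ cong (c ·_) xb≡x ⟨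
        c · (x · b)  ≡⟨ assoc c x b Bc Bx Bb ⟨
        (c · x) · b  ∎)

  B≥-closed : ∀ {x u v} → B x → B≥ B _·_ x u → B≥ B _·_ x v → B≥ B _·_ x (u · v)
  B≥-closed {x} {u} {v} Bx u∈B≥@(Bu , _) v∈B≥@(Bv , _) =
    absorbs⇒B≥ Bx (closed u v Bu Bv) (begin
      x · (u · v)  ≡⟨ assoc x u v Bx Bu Bv ⟨
      (x · u) · v  ≡⟨ cong (_· v) (B≥⇒absorbs Bx u∈B≥) ⟩
      x · v        ≡⟨ B≥⇒absorbs Bx v∈B≥ ⟩
      x            ∎)

  ·-≤ˡ : ∀ {u v} → B u → B v → _≤B_ B _·_ (u · v) u
  ·-≤ˡ {u} {v} Bu Bv = trans (sym (assoc u u v Bu Bu Bv)) (cong (_· v) (idem u Bu))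

  commuting⇒connected : ∀ {x u v} → B x → B≥ B _·_ x u → B≥ B _·_ x v → u · v ≡ v · u →
                        Star (ComparableIn B _·_ (B≥ B _·_ x)) u v
  commuting⇒connected {x} {u} {v} Bx u∈B≥@(Bu , _) v∈B≥@(Bv , _) uv≡vu =
    (u∈B≥ , uv∈B≥ , inj₂ (·-≤ˡ Bu Bv)) ◅
    (uv∈B≥ , v∈B≥ , inj₁ (subst (λ w → _≤B_ B _·_ w v) (sym uv≡vu) (·-≤ˡ Bv Bu))) ◅ ε
    where
      uv∈B≥ : B≥ B _·_ x (u · v)
      uv∈B≥ = B≥-closed Bx u∈B≥ v∈B≥

opposite : Sign → Sign → Bool
opposite ⊕ ⊖ = true
opposite ⊖ ⊕ = true
opposite _ _ = false

·ₛ-assoc : ∀ a b c → (a ·ₛ b) ·ₛ c ≡ a ·ₛ (b ·ₛ c)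
·ₛ-assoc 𝟘 b c = refl
·ₛ-assoc ⊕ b c = refl
·ₛ-assoc ⊖ b c = refl

·ₛ-idem : ∀ a → a ·ₛ a ≡ a
·ₛ-idem 𝟘 = refl
·ₛ-idem ⊕ = refl
·ₛ-idem ⊖ = refl

·ₛ-leftRegular : ∀ a b → (a ·ₛ b) ·ₛ a ≡ a ·ₛ b
·ₛ-leftRegular 𝟘 𝟘 = refl
·ₛ-leftRegular 𝟘 ⊕ = refl
·ₛ-leftRegular 𝟘 ⊖ = refl
·ₛ-leftRegular ⊕ b = refl
·ₛ-leftRegular ⊖ b = refl

·ₛ-comm-¬opposite : ∀ a b → opposite a b ≢ true → a ·ₛ b ≡ b ·ₛ a
·ₛ-comm-¬opposite ⊕ ⊖ ¬opp = ⊥-elim (¬opp refl)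
·ₛ-comm-¬opposite ⊖ ⊕ ¬opp = ⊥-elim (¬opp refl)
·ₛ-comm-¬opposite 𝟘 𝟘 _ = refl
·ₛ-comm-¬opposite 𝟘 ⊕ _ = refl
·ₛ-comm-¬opposite 𝟘 ⊖ _ = refl
·ₛ-comm-¬opposite ⊕ 𝟘 _ = refl
·ₛ-comm-¬opposite ⊕ ⊕ _ = refl
·ₛ-comm-¬opposite ⊖ 𝟘 _ = refl
·ₛ-comm-¬opposite ⊖ ⊖ _ = refl

¬opposite-·ʳ : ∀ a b → opposite a (a ·ₛ b) ≢ true
¬opposite-·ʳ 𝟘 b = λ ()
¬opposite-·ʳ ⊕ b = λ ()
¬opposite-·ʳ ⊖ b = λ ()

¬opposite-·ˡ : ∀ a b → opposite a b ≢ true → opposite (a ·ₛ b) b ≢ true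
¬opposite-·ˡ ⊕ ⊖ ¬opp = ¬opp
¬opposite-·ˡ ⊖ ⊕ ¬opp = ¬opp
¬opposite-·ˡ 𝟘 𝟘 _ = λ ()
¬opposite-·ˡ 𝟘 ⊕ _ = λ ()
¬opposite-·ˡ 𝟘 ⊖ _ = λ ()
¬opposite-·ˡ ⊕ 𝟘 _ = λ ()
¬opposite-·ˡ ⊕ ⊕ _ = λ ()
¬opposite-·ˡ ⊖ 𝟘 _ = λ ()
¬opposite-·ˡ ⊖ ⊖ _ = λ ()

¬opposite-𝟘ʳ : ∀ a → opposite a 𝟘 ≢ true
¬opposite-𝟘ʳ 𝟘 = λ ()
¬opposite-𝟘ʳ ⊕ = λ ()
¬opposite-𝟘ʳ ⊖ = λ ()

¬opposite-𝟘ˡ : ∀ a → opposite 𝟘 a ≢ true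
¬opposite-𝟘ˡ a = λ ()

-- a ·ₛ b ≡ a with b ≠ 𝟘 forces a ≠ 𝟘, and a nonzero sign absorbs everything.
absorbs-opposite : ∀ a b c d → opposite b c ≡ true → a ·ₛ b ≡ a → a ·ₛ d ≡ a
absorbs-opposite ⊕ b c d _ _ = refl
absorbs-opposite ⊖ b c d _ _ = refl
absorbs-opposite 𝟘 ⊕ ⊖ d _ ()
absorbs-opposite 𝟘 ⊖ ⊕ d _ ()

opposite⇒separated : ∀ a b → opposite a b ≡ true → (a ≡ negₛ b) × (a ≢ 𝟘)
opposite⇒separated ⊕ ⊖ _ = refl , λ ()
opposite⇒separated ⊖ ⊕ _ = refl , λ ()

separated⇒opposite : ∀ a b → (a ≡ negₛ b) × (a ≢ 𝟘) → opposite a b ≡ true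
separated⇒opposite 𝟘 b (_ , a≢𝟘) = ⊥-elim (a≢𝟘 refl)
separated⇒opposite ⊕ ⊖ _ = refl
separated⇒opposite ⊖ ⊕ _ = refl
separated⇒opposite ⊕ 𝟘 (() , _)
separated⇒opposite ⊕ ⊕ (() , _)
separated⇒opposite ⊖ 𝟘 (() , _)
separated⇒opposite ⊖ ⊖ (() , _)

module _ {n : ℕ} where
  open ≡-Reasoning

  lookup-∘ᶜ : ∀ (x y : Covector n) i → lookup (x ∘ᶜ y) i ≡ lookup x i ·ₛ lookup y i
  lookup-∘ᶜ x y i = lookup-zipWith _·ₛ_ i x y

  ≡-by-lookup : ∀ {x y : Covector n} → (∀ i → lookup x i ≡ lookup y i) → x ≡ y
  ≡-by-lookup x≗y = Pointwise-≡⇒≡ (ext x≗y)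

  absorbs-at : ∀ {x b : Covector n} → x ∘ᶜ b ≡ x →
               ∀ i → lookup x i ·ₛ lookup b i ≡ lookup x i
  absorbs-at {x} {b} xb≡x i = trans (sym (lookup-∘ᶜ x b i)) (cong (λ w → lookup w i) xb≡x)

  ∘ᶜ-isLeftRegularBand : ∀ {ℓ} {ℒ : Covector n → Set ℓ} →
                         (∀ x y → ℒ x → ℒ y → ℒ (x ∘ᶜ y)) → IsLeftRegularBand ℒ _∘ᶜ_
  ∘ᶜ-isLeftRegularBand closed = record
    { closed = closed
    ; assoc  = λ x y z _ _ _ → zipWith-assoc ·ₛ-assoc x y z
    ; idem   = λ x _ → zipWith-idem ·ₛ-idem x
    ; lrb    = λ x y _ _ → ≡-by-lookup λ i → begin
        lookup ((x ∘ᶜ y) ∘ᶜ x) i           ≡⟨ lookup-∘ᶜ (x ∘ᶜ y) x i ⟩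
        lookup (x ∘ᶜ y) i ·ₛ lookup x i    ≡⟨ cong (_·ₛ lookup x i) (lookup-∘ᶜ x y i) ⟩
        (lookup x i ·ₛ lookup y i) ·ₛ lookup x i  ≡⟨ ·ₛ-leftRegular (lookup x i) (lookup y i) ⟩
        lookup x i ·ₛ lookup y i           ≡⟨ lookup-∘ᶜ x y i ⟨
        lookup (x ∘ᶜ y) i                  ∎
    }

  separation : Covector n → Covector n → Subset n
  separation = zipWith opposite

  ∈separation⇒opposite : ∀ {u v f} → f ∈ separation u v →
                         opposite (lookup u f) (lookup v f) ≡ true
  ∈separation⇒opposite {u} {v} {f} f∈S =
    trans (sym (lookup-zipWith opposite f u v)) ([]=⇒lookup f∈S)

  opposite⇒∈separation : ∀ {u v f} → opposite (lookup u f) (lookup v f) ≡ true →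
                         f ∈ separation u v
  opposite⇒∈separation {u} {v} {f} opp =
    lookup⇒[]= f (separation u v) (trans (lookup-zipWith opposite f u v) opp)

  ∘ᶜ-comm-separation-empty : ∀ {u v} → Empty (separation u v) → u ∘ᶜ v ≡ v ∘ᶜ u
  ∘ᶜ-comm-separation-empty {u} {v} S≡∅ = ≡-by-lookup λ i → begin
    lookup (u ∘ᶜ v) i          ≡⟨ lookup-∘ᶜ u v i ⟩
    lookup u i ·ₛ lookup v i   ≡⟨ ·ₛ-comm-¬opposite _ _ (λ opp → S≡∅ (i , opposite⇒∈separation opp)) ⟩
    lookup v i ·ₛ lookup u i   ≡⟨ lookup-∘ᶜ v u i ⟨
    lookup (v ∘ᶜ u) i          ∎

  record Eliminates (e : Fin n) (u v z : Covector n) : Set where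
    field
      separating : e ∈ separation u v
      vanishes   : lookup z e ≡ 𝟘
      agrees     : ∀ f → f ∉ separation u v → lookup z f ≡ lookup (u ∘ᶜ v) f

  module _ {e : Fin n} {u v z : Covector n} (elim : Eliminates e u v z) where
    open Eliminates elim

    private
      agrees-∘ᶜ : ∀ f → opposite (lookup u f) (lookup v f) ≢ true →
                  lookup z f ≡ lookup u f ·ₛ lookup v f
      agrees-∘ᶜ f ¬opp = trans (agrees f (¬opp ∘ ∈separation⇒opposite)) (lookup-∘ᶜ u v f)

      separation-shrinks : ∀ {p : Subset n} → e ∉ p →
        (∀ f → opposite (lookup u f) (lookup v f) ≢ true → f ∉ p) → p ⊂ separation u v
      separation-shrinks {p} e∉p outside = p⊆S , e , separating , e∉p
        where
          p⊆S : ∀ {f} → f ∈ p → f ∈ separation u v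
          p⊆S {f} f∈p with opposite (lookup u f) (lookup v f) ≟ᵇ true
          ... | yes opp = opposite⇒∈separation opp
          ... | no ¬opp = ⊥-elim (outside f ¬opp f∈p)

    separation-eliminantˡ : separation u z ⊂ separation u v
    separation-eliminantˡ = separation-shrinks
      (λ e∈S → ¬opposite-𝟘ʳ (lookup u e)
        (subst (λ s → opposite (lookup u e) s ≡ true) vanishes (∈separation⇒opposite e∈S)))
      (λ f ¬opp f∈S → ¬opposite-·ʳ (lookup u f) (lookup v f)
        (subst (λ s → opposite (lookup u f) s ≡ true) (agrees-∘ᶜ f ¬opp) (∈separation⇒opposite f∈S)))

    separation-eliminantʳ : separation z v ⊂ separation u v
    separation-eliminantʳ = separation-shrinks
      (λ e∈S → ¬opposite-𝟘ˡ (lookup v e)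
        (subst (λ s → opposite s (lookup v e) ≡ true) vanishes (∈separation⇒opposite e∈S)))
      (λ f ¬opp f∈S → ¬opposite-·ˡ (lookup u f) (lookup v f) ¬opp
        (subst (λ s → opposite s (lookup v f) ≡ true) (agrees-∘ᶜ f ¬opp) (∈separation⇒opposite f∈S)))

    absorbs-eliminant : ∀ {x} → x ∘ᶜ u ≡ x → x ∘ᶜ v ≡ x → x ∘ᶜ z ≡ x
    absorbs-eliminant {x} xu≡x xv≡x = ≡-by-lookup λ i →
      trans (lookup-∘ᶜ x z i) (at i (opposite (lookup u i) (lookup v i) ≟ᵇ true))
      where
        xuv≡x : x ∘ᶜ (u ∘ᶜ v) ≡ x
        xuv≡x = trans (sym (zipWith-assoc ·ₛ-assoc x u v))
                      (trans (cong (_∘ᶜ v) xu≡x) xv≡x)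
        at : ∀ i → Dec (opposite (lookup u i) (lookup v i) ≡ true) →
             lookup x i ·ₛ lookup z i ≡ lookup x i
        at i (yes opp) = absorbs-opposite _ _ _ _ opp (absorbs-at xu≡x i)
        at i (no ¬opp) = begin
          lookup x i ·ₛ lookup z i                     ≡⟨ cong (lookup x i ·ₛ_) (agrees-∘ᶜ i ¬opp) ⟩
          lookup x i ·ₛ (lookup u i ·ₛ lookup v i)     ≡⟨ cong (lookup x i ·ₛ_) (lookup-∘ᶜ u v i) ⟨
          lookup x i ·ₛ lookup (u ∘ᶜ v) i             ≡⟨ absorbs-at xuv≡x i ⟩
          lookup x i                                   ∎

module StrongEliminationSystem {ℓ} {n : ℕ} {ℒ : Covector n → Set ℓ}
                               (H : IsStrongEliminationSystem n ℒ) where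
  open IsStrongEliminationSystem H

  isLeftRegularBand : IsLeftRegularBand ℒ _∘ᶜ_
  isLeftRegularBand = ∘ᶜ-isLeftRegularBand OM2

  open LeftRegularBandProperties isLeftRegularBand

  eliminate : ∀ {u v e} → ℒ u → ℒ v → e ∈ separation u v → ∃ λ z → ℒ z × Eliminates e u v z
  eliminate {u} {v} {e} ℒu ℒv e∈S
    with OM3 u v ℒu ℒv e (opposite⇒separated _ _ (∈separation⇒opposite e∈S))
  ... | z , ℒz , z[e]≡𝟘 , agrees = z , ℒz , record
    { separating = e∈S
    ; vanishes   = z[e]≡𝟘
    ; agrees     = λ f f∉S →
        agrees f (λ f∈S → f∉S (opposite⇒∈separation (separated⇒opposite _ _ f∈S)))
    }

  B≥-connected : ∀ {x} → ℒ x → ∀ u v → Acc _<_ ∣ separation u v ∣ →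
                 B≥ ℒ _∘ᶜ_ x u → B≥ ℒ _∘ᶜ_ x v → Star (ComparableIn ℒ _∘ᶜ_ (B≥ ℒ _∘ᶜ_ x)) u v
  B≥-connected {x} ℒx u v (acc smaller) u∈B≥ v∈B≥ with nonempty? (separation u v)
  ... | no S≡∅ = commuting⇒connected ℒx u∈B≥ v∈B≥ (∘ᶜ-comm-separation-empty S≡∅)
  ... | yes (e , e∈S) with eliminate (proj₁ u∈B≥) (proj₁ v∈B≥) e∈S
  ...   | z , ℒz , elim =
    B≥-connected ℒx u z (smaller (p⊂q⇒∣p∣<∣q∣ (separation-eliminantˡ elim))) u∈B≥ z∈B≥ ◅◅
    B≥-connected ℒx z v (smaller (p⊂q⇒∣p∣<∣q∣ (separation-eliminantʳ elim))) z∈B≥ v∈B≥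
    where
      z∈B≥ : B≥ ℒ _∘ᶜ_ x z
      z∈B≥ = absorbs⇒B≥ ℒx ℒz
              (absorbs-eliminant elim (B≥⇒absorbs ℒx u∈B≥) (B≥⇒absorbs ℒx v∈B≥))

proposition3p19 : ∀ {ℓ : Level} (n : ℕ) (ℒ : Covector n → Set ℓ) →
    IsStrongEliminationSystem n ℒ →
    IsConnectedLeftRegularBand ℒ _∘ᶜ_
proposition3p19 n ℒ H = record
  { isLRB     = isLeftRegularBand
  ; connected = λ x ℒx u v → B≥-connected ℒx u v (<-wellFounded _)
  }
  where open StrongEliminationSystem H
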